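{- Let $H$ be a monotone integer priority queue such that Dijkstra's algorithm using $H$ creates a full ordering on integer N-SSSP instances. Then $H$ can be used to create a $\delta$-PO partial ordering for floating point P-SSSP: running Dijkstra's algorithm on a floating point P-SSSP instance with minimum edge length $\delta>0$, keying each node $u$ in $H$ by $\hat D(u)=\lfloor D(u)/\delta\rfloor$ (recomputed whenever $D(u)$ decreases), yields a processing order $v_1,\dots,v_n$ with $i<j\Rightarrow d(v_i)<d(v_j)+\delta$.
   Context: SSSP: given a graph $G=(V,E)$ with edge lengths $\ell$ and source $s$, compute the shortest path lengths $d(v)$ from $s$ and a shortest path tree. N-SSSP: all edge lengths nonnegative; P-SSSP: all edge lengths satisfy $\ell(\varepsilon)\ge\delta>0$, $\delta$ being the minimum edge length. "Integer"/"floating point" refers to the edge weight type. Dijkstra's algorithm maintains tentative distances $D(v)$ (initially $\infty$, $D(s)=0$), repeatedly processes a node extracted from the priority queue (first $s$), fixing its distance and relaxing its out-edges; $v_1,\dots,v_n$ denotes the processing order. A full ordering satisfies $i<j\Rightarrow d(v_i)\le d(v_j)$; a $\delta$-PO satisfies $i<j\Rightarrow d(v_i)<d(v_j)+\delta$. A monotone integer priority queue extracts integer keys in nondecreasing order. -}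

module Defs where

open import Data.Nat as ℕ using (ℕ; zero; suc)
open import Data.Integer as ℤ using (ℤ)
open import Data.Rational as ℚ using (ℚ; 0ℚ)
open import Data.Rational.Properties as ℚP using ()
open import Data.Fin as Fin using (Fin)
open import Data.Maybe using (Maybe; just; nothing)
open import Data.Product using (Σ; ∃; _×_; _,_)
open import Data.List using (List; []; _∷_; _++_; [_]; length; lookup; foldl)
open import Data.List using () renaming (allFin to allFinL)
open import Data.Bool using (Bool; true; false; if_then_else_)
open import Relation.Nullary using (does)
open import Relation.Binary.PropositionalEquality using (_≡_)

Graph : Set → ℕ → Set
Graph W n = Fin n → Fin n → Maybe W

data Walk {W : Set} {n : ℕ} (G : Graph W n) : Fin n → Fin n → Set where
  []   : ∀ {v} → Walk G v v
  edge : ∀ {u w v} (ℓ : W) → G u w ≡ just ℓ → Walk G w v → Walk G u v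

walkLength : {W : Set} {n : ℕ} {G : Graph W n} (z : W) (_+_ : W → W → W)
           → ∀ {u v} → Walk G u v → W
walkLength z _+_ []             = z
walkLength z _+_ (edge ℓ _ p)   = ℓ + walkLength z _+_ p

IsDist : {W : Set} {n : ℕ} (z : W) (_+_ : W → W → W) (_≤_ : W → W → Set)
       → Graph W n → Fin n → Fin n → W → Set
IsDist z _+_ _≤_ G s v x =
  (Σ (Walk G s v) λ p → walkLength z _+_ p ≡ x) ×
  (∀ (p : Walk G s v) → x ≤ walkLength z _+_ p)

update : {A : Set} {n : ℕ} → (Fin n → A) → Fin n → A → Fin n → A
update f v a u = if does (u Fin.≟ v) then a else f u

record PQ (n : ℕ) : Set₁ where
  field
    State       : Set
    empty       : State
    insert      : Fin n → ℕ → State → State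
    decreaseKey : Fin n → ℕ → State → State
    extract     : State → Maybe (Fin n × State)
    -- abstraction: the key of each element currently in the queue
    contents    : State → Fin n → Maybe ℕ

module _ {n : ℕ} (H : PQ n) where
  open PQ H

  -- States reachable by monotone usage; the index b is the key of the
  -- last extracted element (0 initially).  Inserted / decreased keys
  -- must be ≥ b.
  data Reach : State → ℕ → Set where
    r-empty  : Reach empty 0
    r-insert : ∀ {s b v k} → Reach s b → contents s v ≡ nothing → b ℕ.≤ k
             → Reach (insert v k s) b
    r-dec    : ∀ {s b v k k'} → Reach s b → contents s v ≡ just k' → k ℕ.≤ k'
             → b ℕ.≤ k → Reach (decreaseKey v k s) b
    r-ext    : ∀ {s b v s' k} → Reach s b → extract s ≡ just (v , s')
             → contents s v ≡ just k → Reach s' k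

  record IsMonotonePQ : Set where
    field
      contents-empty  : ∀ u → contents empty u ≡ nothing
      contents-insert : ∀ {s b v k} → Reach s b → contents s v ≡ nothing → b ℕ.≤ k
                      → ∀ u → contents (insert v k s) u ≡ update (contents s) v (just k) u
      contents-dec    : ∀ {s b v k k'} → Reach s b → contents s v ≡ just k' → k ℕ.≤ k'
                      → b ℕ.≤ k
                      → ∀ u → contents (decreaseKey v k s) u ≡ update (contents s) v (just k) u
      extract-nothing : ∀ {s b} → Reach s b → extract s ≡ nothing
                      → ∀ u → contents s u ≡ nothing
      extract-just    : ∀ {s b v s'} → Reach s b → extract s ≡ just (v , s')
                      → (∀ u → contents s' u ≡ update (contents s) v nothing u) ×
                        (∃ λ k → contents s v ≡ just k × b ℕ.≤ k)

record Config {n : ℕ} (W : Set) (H : PQ n) : Set where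
  constructor config
  field
    D     : Fin n → Maybe W      -- tentative distances (nothing = ∞)
    done  : Fin n → Bool
    queue : PQ.State H
    order : List (Fin n)

module Dijkstra {W : Set} (z : W) (_+_ : W → W → W) (_<ᵇ_ : W → W → Bool)
                (key : W → ℕ) {n : ℕ} (H : PQ n) (G : Graph W n) where
  open PQ H

  relax : W → Fin n → Config W H → Fin n → Config W H
  relax du u c t with G u t | Config.done c t | Config.D c t
  ... | nothing | _     | _       = c
  ... | just ℓ  | true  | _       = c
  ... | just ℓ  | false | nothing =
    config (update (Config.D c) t (just (du + ℓ))) (Config.done c)
           (insert t (key (du + ℓ)) (Config.queue c)) (Config.order c)
  ... | just ℓ  | false | just dt =
    if (du + ℓ) <ᵇ dt
    then config (update (Config.D c) t (just (du + ℓ))) (Config.done c)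
                (decreaseKey t (key (du + ℓ)) (Config.queue c)) (Config.order c)
    else c

  process : Fin n → State → Config W H → Config W H
  process u q c with Config.D c u
  ... | nothing = c'
    where c' = config (Config.D c) (update (Config.done c) u true) q
                      (Config.order c ++ [ u ])
  ... | just du = foldl (relax du u) c' (allFinL n)
    where c' = config (Config.D c) (update (Config.done c) u true) q
                      (Config.order c ++ [ u ])

  loop : ℕ → Config W H → Config W H
  loop zero    c = c
  loop (suc f) c with extract (Config.queue c)
  ... | nothing       = c
  ... | just (u , q') = loop f (process u q' c)

  initial : Fin n → Config W H
  initial s = config (update (λ _ → nothing) s (just z)) (λ _ → false)
                     (insert s (key z) empty) []

  -- the processing order v₁,…,v_k produced from source s
  -- (each node is inserted at most once, so n extractions suffice)
  processingOrder : Fin n → List (Fin n)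
  processingOrder s = Config.order (loop n (initial s))

dijkstraℕ : {n : ℕ} → PQ n → Graph ℕ n → Fin n → List (Fin n)
dijkstraℕ H G s = Dijkstra.processingOrder 0 ℕ._+_ ℕ._<ᵇ_ (λ x → x) H G s

FullOrdering : {n : ℕ} → Graph ℕ n → Fin n → List (Fin n) → Set
FullOrdering G s vs =
  ∀ (i j : Fin (length vs)) → i Fin.< j → ∀ x y →
  IsDist 0 ℕ._+_ ℕ._≤_ G s (lookup vs i) x →
  IsDist 0 ℕ._+_ ℕ._≤_ G s (lookup vs j) y → x ℕ.≤ y

-- "Floating point" P-SSSP: weights in ℚ, H keyed by ⌊D(u)/δ⌋.

_<ᵇℚ_ : ℚ → ℚ → Bool
p <ᵇℚ q = does (p ℚP.<? q)

-- ⌊ x / δ ⌋ (as a natural number; it is ≥ 0 for the x ≥ 0 that occur)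
scaledKey : (δ : ℚ) → 0ℚ ℚ.< δ → ℚ → ℕ
scaledKey δ δ>0 x = ℤ.∣ ℚ.floor (ℚ._÷_ x δ {{ℚ.>-nonZero δ>0}}) ∣

dijkstraℚ : {n : ℕ} → PQ n → Graph ℚ n → (δ : ℚ) → 0ℚ ℚ.< δ → Fin n → List (Fin n)
dijkstraℚ H G δ δ>0 s =
  Dijkstra.processingOrder 0ℚ ℚ._+_ _<ᵇℚ_ (scaledKey δ δ>0) H G s

MinEdgeLength : {n : ℕ} → Graph ℚ n → ℚ → Set
MinEdgeLength G δ =
  (∀ u v ℓ → G u v ≡ just ℓ → δ ℚ.≤ ℓ) × (∃ λ u → ∃ λ v → G u v ≡ just δ)

DeltaPO : {n : ℕ} → Graph ℚ n → Fin n → ℚ → List (Fin n) → Set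
DeltaPO G s δ vs =
  ∀ (i j : Fin (length vs)) → i Fin.< j → ∀ x y →
  IsDist 0ℚ ℚ._+_ ℚ._≤_ G s (lookup vs i) x →
  IsDist 0ℚ ℚ._+_ ℚ._≤_ G s (lookup vs j) y → x ℚ.< y ℚ.+ δ

-- A monotone queue extracts the keys ⌊D(u)/δ⌋ in nondecreasing order, and each extracted key
-- is a minimum of the queue. When u is extracted, D(u) = d(u): on any walk s ⇝ u let a be the
-- first unprocessed node; relaxed edges give D(a) ≤ length of the prefix, and if a ≠ u then
-- ⌊D(u)/δ⌋ ≤ ⌊D(a)/δ⌋ gives D(u) < D(a) + δ, while the rest of the walk has length ≥ δ.
-- So ⌊d(vᵢ)/δ⌋ is nondecreasing along the processing order, and ⌊x/δ⌋ ≤ ⌊y/δ⌋ gives x < y + δ.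
module Submission where

open import Defs
open import Data.Nat using (ℕ)
open import Data.Rational using (ℚ; 0ℚ; _<_)
open import Data.Fin using (Fin)

open import Data.Bool using (Bool; true; false)
open import Data.Empty using (⊥)
import Data.Fin as Fin
import Data.Integer as ℤ
import Data.Integer.Properties as ℤP
open import Data.List using (List; []; _∷_; _++_; [_]; map; allFin; foldl; length; lookup)
open import Data.List.Membership.Propositional using (_∈_)
open import Data.List.Membership.Propositional.Properties using (∈-allFin; ∈-lookup)
open import Data.List.Relation.Unary.All as All using (All; []; _∷_)
import Data.List.Relation.Unary.All.Properties as AllP
open import Data.List.Relation.Unary.AllPairs using (AllPairs; []; _∷_)
import Data.List.Relation.Unary.AllPairs.Properties as AllPairsP
open import Data.List.Relation.Unary.Any using (here; there)
open import Data.Maybe using (Maybe; just; nothing)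
open import Data.Maybe.Properties using (just-injective)
import Data.Nat as ℕ
open import Data.Nat.Coprimality using (Coprime)
open import Data.Nat.DivMod using (_/_; m/n*n≤m; m*n/n≡m; /-monoˡ-≤)
open import Data.Nat.ListAction using (sum)
import Data.Nat.Properties as ℕP
open import Algebra.Properties.CommutativeSemigroup ℕP.*-commutativeSemigroup using (xy∙z≈xz∙y)
open import Data.Product using (Σ; _×_; _,_; proj₁; proj₂)
import Data.Rational as ℚ
import Data.Rational.Properties as ℚP
import Data.Rational.Unnormalised as ℚᵘ
import Data.Rational.Unnormalised.Properties as ℚᵘP
open import Function using (_∘_; case_of_)
open import Relation.Binary.PropositionalEquality hiding ([_])
open import Relation.Nullary using (¬_; yes; no; contradiction; proof; ofʸ; ofⁿ)

/-+-≤ : ∀ a d c e m → (a ℕ.+ m ℕ.* ℕ.suc d) ℕ.* ℕ.suc e ℕ.≤ c ℕ.* ℕ.suc d →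
        m ℕ.+ a / ℕ.suc d ℕ.≤ c / ℕ.suc e
/-+-≤ a d c e m h = begin
  m ℕ.+ f                            ≡⟨ m*n/n≡m (m ℕ.+ f) (ℕ.suc e) ⟨
  (m ℕ.+ f) ℕ.* ℕ.suc e / ℕ.suc e
    ≤⟨ /-monoˡ-≤ (ℕ.suc e) (ℕP.*-cancelʳ-≤ ((m ℕ.+ f) ℕ.* ℕ.suc e) c (ℕ.suc d) scaled) ⟩
  c / ℕ.suc e                        ∎
  where
  open ℕP.≤-Reasoning
  f : ℕ
  f = a / ℕ.suc d
  scaled : (m ℕ.+ f) ℕ.* ℕ.suc e ℕ.* ℕ.suc d ℕ.≤ c ℕ.* ℕ.suc d
  scaled = begin
    (m ℕ.+ f) ℕ.* ℕ.suc e ℕ.* ℕ.suc d   ≡⟨ xy∙z≈xz∙y (m ℕ.+ f) (ℕ.suc e) (ℕ.suc d) ⟩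
    (m ℕ.+ f) ℕ.* ℕ.suc d ℕ.* ℕ.suc e   ≡⟨ cong (ℕ._* ℕ.suc e) (ℕP.*-distribʳ-+ (ℕ.suc d) m f) ⟩
    (m ℕ.* ℕ.suc d ℕ.+ f ℕ.* ℕ.suc d) ℕ.* ℕ.suc e
      ≤⟨ ℕP.*-monoˡ-≤ (ℕ.suc e) (ℕP.+-monoʳ-≤ (m ℕ.* ℕ.suc d) (m/n*n≤m a (ℕ.suc d))) ⟩
    (m ℕ.* ℕ.suc d ℕ.+ a) ℕ.* ℕ.suc e   ≡⟨ cong (ℕ._* ℕ.suc e) (ℕP.+-comm (m ℕ.* ℕ.suc d) a) ⟩
    (a ℕ.+ m ℕ.* ℕ.suc d) ℕ.* ℕ.suc e   ≤⟨ h ⟩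
    c ℕ.* ℕ.suc d                       ∎

∣⌊mkℚ⌋∣ : ∀ a d .(cop : Coprime a (ℕ.suc d)) → ℤ.∣ ℚ.floor (ℚ.mkℚ (ℤ.+ a) d cop) ∣ ≡ a / ℕ.suc d
∣⌊mkℚ⌋∣ a d cop = cong ℤ.∣_∣ (ℤP.*-identityˡ (ℤ.+ (a / ℕ.suc d)))

-- Stated in ℚᵘ since ℚ-addition normalises and would hide the shape of p + m.
m+∣⌊p⌋∣≤∣⌊q⌋∣ : ∀ p q .{{_ : ℚ.NonNegative p}} .{{_ : ℚ.NonNegative q}} m →
                ℚ.toℚᵘ p ℚᵘ.+ ℚᵘ.mkℚᵘ (ℤ.+ m) 0 ℚᵘ.≤ ℚ.toℚᵘ q →
                m ℕ.+ ℤ.∣ ℚ.floor p ∣ ℕ.≤ ℤ.∣ ℚ.floor q ∣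
m+∣⌊p⌋∣≤∣⌊q⌋∣ (ℚ.mkℚ (ℤ.+ a) d cp) (ℚ.mkℚ (ℤ.+ c) e cq) m (ℚᵘ.*≤* h) =
  subst₂ ℕ._≤_ (cong (m ℕ.+_) (sym (∣⌊mkℚ⌋∣ a d cp))) (sym (∣⌊mkℚ⌋∣ c e cq))
         (/-+-≤ a d c e m (ℤP.drop‿+≤+ (subst₂ ℤ._≤_ lhs rhs h)))
  where
  open ≡-Reasoning
  lhs : (ℤ.+ a ℤ.* ℤ.+ 1 ℤ.+ ℤ.+ m ℤ.* ℤ.+ ℕ.suc d) ℤ.* ℤ.+ ℕ.suc e
      ≡ ℤ.+ ((a ℕ.+ m ℕ.* ℕ.suc d) ℕ.* ℕ.suc e)
  lhs = begin
    (ℤ.+ a ℤ.* ℤ.+ 1 ℤ.+ ℤ.+ m ℤ.* ℤ.+ ℕ.suc d) ℤ.* ℤ.+ ℕ.suc e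
      ≡⟨ cong (λ x → (x ℤ.+ ℤ.+ m ℤ.* ℤ.+ ℕ.suc d) ℤ.* ℤ.+ ℕ.suc e) (ℤP.*-identityʳ (ℤ.+ a)) ⟩
    (ℤ.+ a ℤ.+ ℤ.+ m ℤ.* ℤ.+ ℕ.suc d) ℤ.* ℤ.+ ℕ.suc e
      ≡⟨ cong (λ x → (ℤ.+ a ℤ.+ x) ℤ.* ℤ.+ ℕ.suc e) (ℤP.pos-* m (ℕ.suc d)) ⟨
    ℤ.+ (a ℕ.+ m ℕ.* ℕ.suc d) ℤ.* ℤ.+ ℕ.suc e
      ≡⟨ ℤP.pos-* (a ℕ.+ m ℕ.* ℕ.suc d) (ℕ.suc e) ⟨
    ℤ.+ ((a ℕ.+ m ℕ.* ℕ.suc d) ℕ.* ℕ.suc e) ∎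
  rhs : ℤ.+ c ℤ.* ℤ.+ (ℕ.suc d ℕ.* 1) ≡ ℤ.+ (c ℕ.* ℕ.suc d)
  rhs = trans (sym (ℤP.pos-* c (ℕ.suc d ℕ.* 1))) (cong (λ x → ℤ.+ (c ℕ.* x)) (ℕP.*-identityʳ (ℕ.suc d)))

module ScaledKey (δ : ℚ) (δ>0 : 0ℚ < δ) where
  private
    instance
      δ-nonZero : ℚ.NonZero δ
      δ-nonZero = ℚ.>-nonZero δ>0
      δ-positive : ℚ.Positive δ
      δ-positive = ℚ.positive δ>0

    1/δ-positive : ℚ.Positive (ℚ.1/ δ)
    1/δ-positive = ℚP.1/pos⇒pos δ

    instance
      1/δ-nonNeg : ℚ.NonNegative (ℚ.1/ δ)
      1/δ-nonNeg = ℚP.pos⇒nonNeg (ℚ.1/ δ) {{1/δ-positive}}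

    ÷δ-nonNeg : ∀ {x} → 0ℚ ℚ.≤ x → ℚ.NonNegative (x ℚ.÷ δ)
    ÷δ-nonNeg {x} x≥0 = ℚP.nonNeg*nonNeg⇒nonNeg x {{ℚ.nonNegative x≥0}} (ℚ.1/ δ)

    ÷δ-mono-≤ : ∀ {x y} → x ℚ.≤ y → ℚ.toℚᵘ (x ℚ.÷ δ) ℚᵘ.≤ ℚ.toℚᵘ (y ℚ.÷ δ)
    ÷δ-mono-≤ x≤y = ℚP.toℚᵘ-mono-≤ (ℚP.*-monoʳ-≤-nonNeg (ℚ.1/ δ) x≤y)

  key : ℚ → ℕ
  key = scaledKey δ δ>0

  key-mono-≤ : ∀ {x y} → 0ℚ ℚ.≤ x → x ℚ.≤ y → key x ℕ.≤ key y
  key-mono-≤ {x} {y} x≥0 x≤y =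
    m+∣⌊p⌋∣≤∣⌊q⌋∣ (x ℚ.÷ δ) (y ℚ.÷ δ) {{÷δ-nonNeg x≥0}} {{÷δ-nonNeg (ℚP.≤-trans x≥0 x≤y)}} 0
      (ℚᵘP.≤-respˡ-≃ (ℚᵘP.≃-sym (ℚᵘP.+-identityʳ (ℚ.toℚᵘ (x ℚ.÷ δ)))) (÷δ-mono-≤ x≤y))

  -- Adding δ raises the key by at least one.
  key≤⇒<+δ : ∀ {x y} → 0ℚ ℚ.≤ x → 0ℚ ℚ.≤ y → key x ℕ.≤ key y → x ℚ.< y ℚ.+ δ
  key≤⇒<+δ {x} {y} x≥0 y≥0 kx≤ky with x ℚP.<? y ℚ.+ δ
  ... | yes x<y+δ = x<y+δ
  ... | no x≮y+δ = contradiction (ℕP.<-≤-trans key[y]<key[x] kx≤ky) (ℕP.n≮n (key y))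
    where
    y+δ≤x : y ℚ.+ δ ℚ.≤ x
    y+δ≤x = ℚP.≮⇒≥ x≮y+δ
    [y+δ]÷δ : (y ℚ.+ δ) ℚ.÷ δ ≡ y ℚ.÷ δ ℚ.+ ℚ.1ℚ
    [y+δ]÷δ = trans (ℚP.*-distribʳ-+ (ℚ.1/ δ) y δ) (cong (y ℚ.÷ δ ℚ.+_) (ℚP.*-inverseʳ δ))
    key[y]<key[x] : key y ℕ.< key x
    key[y]<key[x] =
      m+∣⌊p⌋∣≤∣⌊q⌋∣ (y ℚ.÷ δ) (x ℚ.÷ δ) {{÷δ-nonNeg y≥0}} {{÷δ-nonNeg x≥0}} 1
        (ℚᵘP.≤-respˡ-≃ (ℚᵘP.≃-trans (ℚP.toℚᵘ-cong [y+δ]÷δ) (ℚP.toℚᵘ-homo-+ (y ℚ.÷ δ) ℚ.1ℚ))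
          (÷δ-mono-≤ y+δ≤x))

module _ {n : ℕ} where

  update-same : ∀ {A : Set} (f : Fin n → A) v a → update f v a v ≡ a
  update-same f v a with v Fin.≟ v
  ... | yes _ = refl
  ... | no v≢v = contradiction refl v≢v

  update-other : ∀ {A : Set} (f : Fin n → A) v a {u} → u ≢ v → update f v a u ≡ f u
  update-other f v a {u} u≢v with u Fin.≟ v
  ... | yes u≡v = contradiction u≡v u≢v
  ... | no _ = refl

module _ {n : ℕ} {A : Set} where

  occupied : Maybe A → ℕ
  occupied nothing = 0
  occupied (just _) = 1

  occupancy : (Fin n → Maybe A) → List (Fin n) → ℕ
  occupancy f = sum ∘ map (occupied ∘ f)

  occupancy-mono : ∀ {f g} → (∀ x → occupied (g x) ℕ.≤ occupied (f x)) →
                   ∀ xs → occupancy g xs ℕ.≤ occupancy f xs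
  occupancy-mono g≤f []       = ℕ.z≤n
  occupancy-mono g≤f (x ∷ xs) = ℕP.+-mono-≤ (g≤f x) (occupancy-mono g≤f xs)

  occupancy-mono-strict : ∀ {f g} → (∀ x → occupied (g x) ℕ.≤ occupied (f x)) →
                    ∀ {v xs} → v ∈ xs → occupied (g v) ℕ.< occupied (f v) →
                    occupancy g xs ℕ.< occupancy f xs
  occupancy-mono-strict g≤f {xs = x ∷ xs} (here refl) g<f = ℕP.+-mono-<-≤ g<f (occupancy-mono g≤f xs)
  occupancy-mono-strict g≤f {xs = x ∷ xs} (there v∈xs) g<f =
    ℕP.+-mono-≤-< (g≤f x) (occupancy-mono-strict g≤f v∈xs g<f)

  occupancy-remove : ∀ {f g : Fin n → Maybe A} {v k} → (∀ x → g x ≡ update f v nothing x) →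
                     f v ≡ just k → occupancy g (allFin n) ℕ.< occupancy f (allFin n)
  occupancy-remove {f} {g} {v} g≗ fv = occupancy-mono-strict removed≤ (∈-allFin v) removed<
    where
    removed≤ : ∀ x → occupied (g x) ℕ.≤ occupied (f x)
    removed≤ x rewrite g≗ x with x Fin.≟ v
    ... | yes _ = ℕ.z≤n
    ... | no _  = ℕP.≤-refl
    removed< : occupied (g v) ℕ.< occupied (f v)
    removed< rewrite g≗ v | update-same f v nothing | fv = ℕP.≤-refl

module MonotoneQueue {n : ℕ} (H : PQ n) (mono : IsMonotonePQ H) where
  open PQ H
  open IsMonotonePQ mono

  -- The specification only bounds extracted keys from below by the previous one; that the
  -- extracted key is a minimum follows by extracting until the queue is empty.
  keys-above-bound : ∀ N {st b u j} → occupancy (contents st) (allFin n) ℕ.< N →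
                     Reach H st b → contents st u ≡ just j → b ℕ.≤ j
  keys-above-bound (ℕ.suc N) {st} {b} {u} {j} size<N r cu with extract st in e
  ... | nothing = contradiction (trans (sym cu) (extract-nothing r e u)) λ ()
  ... | just (v , st') with extract-just r e
  ...   | st'≗ , k , cv , b≤k with u Fin.≟ v
  ...     | yes refl = subst (b ℕ.≤_) (just-injective (trans (sym cv) cu)) b≤k
  ...     | no u≢v = ℕP.≤-trans b≤k (keys-above-bound N size'<N (r-ext r e cv) cu')
    where
    size'<N : occupancy (contents st') (allFin n) ℕ.< N
    size'<N = ℕP.<-≤-trans (occupancy-remove st'≗ cv) (ℕP.≤-pred size<N)
    cu' : contents st' u ≡ just j
    cu' = trans (st'≗ u) (trans (update-other (contents st) v nothing u≢v) cu)

  extract-min : ∀ {st b v st' k w j} → Reach H st b → extract st ≡ just (v , st') →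
                contents st v ≡ just k → contents st w ≡ just j → k ℕ.≤ j
  extract-min {st} {v = v} {w = w} r e cv cw with w Fin.≟ v
  ... | yes refl = ℕP.≤-reflexive (just-injective (trans (sym cv) cw))
  ... | no w≢v = keys-above-bound _ ℕP.≤-refl (r-ext r e cv)
                   (trans (proj₁ (extract-just r e) w) (trans (update-other (contents st) v nothing w≢v) cw))

lookup-AllPairs : ∀ {A : Set} {R : A → A → Set} {xs : List A} → AllPairs R xs →
                  ∀ (i j : Fin (length xs)) → i Fin.< j → R (lookup xs i) (lookup xs j)
lookup-AllPairs (Rx ∷ _)   Fin.zero    (Fin.suc j) _           = All.lookup Rx (∈-lookup j)
lookup-AllPairs (_ ∷ Rxs) (Fin.suc i) (Fin.suc j) (ℕ.s≤s i<j) = lookup-AllPairs Rxs i j i<j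

p≤p+q : ∀ {p q} → 0ℚ ℚ.≤ q → p ℚ.≤ p ℚ.+ q
p≤p+q {p} {q} q≥0 = ℚP.≤-trans (ℚP.≤-reflexive (sym (ℚP.+-identityʳ p))) (ℚP.+-monoʳ-≤ p q≥0)

module _ {n : ℕ} {G : Graph ℚ n} where

  len : ∀ {u v} → Walk G u v → ℚ
  len = walkLength 0ℚ ℚ._+_

  snoc : ∀ {a b w ℓ} → Walk G a b → G b w ≡ just ℓ → Walk G a w
  snoc []              e = edge _ e []
  snoc (edge ℓ' e' p) e = edge ℓ' e' (snoc p e)

  len-snoc : ∀ {a b w ℓ} (p : Walk G a b) (e : G b w ≡ just ℓ) → len (snoc p e) ≡ len p ℚ.+ ℓ
  len-snoc {ℓ = ℓ} []             e = trans (ℚP.+-identityʳ ℓ) (sym (ℚP.+-identityˡ ℓ))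
  len-snoc {ℓ = ℓ} (edge ℓ' e' p) e = trans (cong (ℓ' ℚ.+_) (len-snoc p e)) (sym (ℚP.+-assoc ℓ' (len p) ℓ))

module Correctness {n : ℕ} (H : PQ n) (mono : IsMonotonePQ H) (G : Graph ℚ n) (s : Fin n)
                   (δ : ℚ) (δ>0 : 0ℚ < δ) (δ≤ℓ : ∀ u v ℓ → G u v ≡ just ℓ → δ ℚ.≤ ℓ) where
  open PQ H
  open IsMonotonePQ mono
  open MonotoneQueue H mono
  open ScaledKey δ δ>0
  open Dijkstra 0ℚ ℚ._+_ _<ᵇℚ_ key H G
  open Config

  ℓ≥0 : ∀ {u v ℓ} → G u v ≡ just ℓ → 0ℚ ℚ.≤ ℓ
  ℓ≥0 {u} {v} {ℓ} e = ℚP.≤-trans (ℚP.<⇒≤ δ>0) (δ≤ℓ u v ℓ e)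

  len≥0 : ∀ {u v} (p : Walk G u v) → 0ℚ ℚ.≤ len p
  len≥0 []           = ℚP.≤-refl
  len≥0 (edge ℓ e p) = ℚP.+-mono-≤ (ℓ≥0 e) (len≥0 p)

  δ≤len-edge : ∀ {u w v ℓ} (e : G u w ≡ just ℓ) (p : Walk G w v) → δ ℚ.≤ len (edge ℓ e p)
  δ≤len-edge {u} {w} {ℓ = ℓ} e p = ℚP.≤-trans (δ≤ℓ u w ℓ e) (p≤p+q (len≥0 p))

  Dist : Fin n → ℚ → Set
  Dist = IsDist 0ℚ ℚ._+_ ℚ._≤_ G s

  Dist-nonNeg : ∀ {v x} → Dist v x → 0ℚ ℚ.≤ x
  Dist-nonNeg ((p , refl) , _) = len≥0 p

  Dist-unique : ∀ {v x y} → Dist v x → (Σ (Walk G s v) λ p → len p ≡ y) →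
                (∀ (p : Walk G s v) → y ℚ.≤ len p) → x ≡ y
  Dist-unique ((p , refl) , x-min) (q , refl) y-min = ℚP.≤-antisym (x-min q) (y-min p)

  KeyBelow : ℕ → Fin n → Set
  KeyBelow b v = ∀ x → Dist v x → key x ℕ.≤ b

  KeyOrdered : Fin n → Fin n → Set
  KeyOrdered v w = ∀ x y → Dist v x → Dist w y → key x ℕ.≤ key y

  extend-order : ∀ {vs b k u} → All (KeyBelow b) vs → AllPairs KeyOrdered vs → b ℕ.≤ k →
                 (∀ x → Dist u x → key x ≡ k) →
                 All (KeyBelow k) (vs ++ [ u ]) × AllPairs KeyOrdered (vs ++ [ u ])
  extend-order {b = b} {k} {u} below sorted b≤k key[u] =
    AllP.++⁺ (All.map (λ v≤b x d → ℕP.≤-trans (v≤b x d) b≤k) below)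
             ((λ x d → ℕP.≤-reflexive (key[u] x d)) ∷ []) ,
    AllPairsP.++⁺ sorted ([] ∷ []) (All.map (λ v≤b → v≤u v≤b ∷ []) below)
    where
    v≤u : ∀ {v} → KeyBelow b v → KeyOrdered v u
    v≤u v≤b x y dx dy = ℕP.≤-trans (v≤b x dx) (ℕP.≤-trans b≤k (ℕP.≤-reflexive (sym (key[u] y dy))))

  queueEntry : Bool → Maybe ℚ → Maybe ℕ
  queueEntry true  _        = nothing
  queueEntry false nothing  = nothing
  queueEntry false (just d) = just (key d)

  -- Exempt p w marks edges p → w that have not been relaxed yet.
  Frontier : (Fin n → Fin n → Set) → Config ℚ H → Set
  Frontier Exempt c = ∀ p w → ¬ Exempt p w → done c p ≡ true → ∀ ℓ → G p w ≡ just ℓ →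
                      ∀ dp → D c p ≡ just dp → Σ ℚ λ dw → D c w ≡ just dw × dw ℚ.≤ dp ℚ.+ ℓ

  NoExempt : Fin n → Fin n → Set
  NoExempt _ _ = ⊥

  record Invariant (Exempt : Fin n → Fin n → Set) (c : Config ℚ H) (b : ℕ) : Set where
    field
      queue-reach    : Reach H (queue c) b
      queue-contents : ∀ v → contents (queue c) v ≡ queueEntry (done c v) (D c v)
      D-attained     : ∀ v dv → D c v ≡ just dv → Σ (Walk G s v) λ p → len p ≡ dv
      done-exact     : ∀ v → done c v ≡ true →
                       Σ ℚ λ dv → D c v ≡ just dv × (∀ (p : Walk G s v) → dv ℚ.≤ len p)
      frontier       : Frontier Exempt c
      D-source       : D c s ≡ just 0ℚ
      order-below    : All (KeyBelow b) (order c)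
      order-sorted   : AllPairs KeyOrdered (order c)
  open Invariant

  withFrontier : ∀ {E E' c b} → Invariant E c b → Frontier E' c → Invariant E' c b
  withFrontier I F = record
    { queue-reach = queue-reach I ; queue-contents = queue-contents I ; D-attained = D-attained I
    ; done-exact = done-exact I ; frontier = F ; D-source = D-source I
    ; order-below = order-below I ; order-sorted = order-sorted I }

  D-nonNeg : ∀ {E c b} → Invariant E c b → ∀ {v dv} → D c v ≡ just dv → 0ℚ ℚ.≤ dv
  D-nonNeg I {v} {dv} e with D-attained I v dv e
  ... | p , refl = len≥0 p

  queued : ∀ {E c b v dv} → Invariant E c b → done c v ≡ false → D c v ≡ just dv →
           contents (queue c) v ≡ just (key dv)
  queued I undone Dv = trans (queue-contents I _) (cong₂ queueEntry undone Dv)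

  module _ {c : Config ℚ H} {b : ℕ} (I : Invariant NoExempt c b) {u : Fin n} {du : ℚ}
           (u-undone : done c u ≡ false) (Du : D c u ≡ just du)
           (u-min : ∀ w j → contents (queue c) w ≡ just j → key du ℕ.≤ j) where

    ≤-along-walk : ∀ a (Q : Walk G a u) acc da → D c a ≡ just da → da ℚ.≤ acc →
                   du ℚ.≤ acc ℚ.+ len Q
    ≤-along-walk a Q acc da Da da≤acc with done c a in a-done
    ≤-along-walk a [] acc da Da da≤acc | true = contradiction (trans (sym a-done) u-undone) λ ()
    ≤-along-walk a (edge ℓ e Q) acc da Da da≤acc | true with frontier I a _ (λ ()) a-done ℓ e da Da
    ... | dw , Dw , dw≤ =
      ℚP.≤-trans (≤-along-walk _ Q (acc ℚ.+ ℓ) dw Dw (ℚP.≤-trans dw≤ (ℚP.+-monoˡ-≤ ℓ da≤acc)))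
                 (ℚP.≤-reflexive (ℚP.+-assoc acc ℓ (len Q)))
    ≤-along-walk a [] acc da Da da≤acc | false with trans (sym Du) Da
    ... | refl = ℚP.≤-trans da≤acc (ℚP.≤-reflexive (sym (ℚP.+-identityʳ acc)))
    ≤-along-walk a (edge ℓ e Q) acc da Da da≤acc | false =
      ℚP.<⇒≤ (ℚP.<-≤-trans (key≤⇒<+δ (D-nonNeg I Du) (D-nonNeg I Da) (u-min a (key da) (queued I a-done Da)))
                           (ℚP.+-mono-≤ da≤acc (δ≤len-edge e Q)))

    extracted-exact : ∀ (P : Walk G s u) → du ℚ.≤ len P
    extracted-exact P = ℚP.≤-trans (≤-along-walk s P 0ℚ 0ℚ (D-source I) ℚP.≤-refl)
                                   (ℚP.≤-reflexive (ℚP.+-identityˡ (len P)))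

  module Relaxation (u : Fin n) (du : ℚ) (Pu : Walk G s u) (len[Pu] : len Pu ≡ du)
                    (du-exact : ∀ (P : Walk G s u) → du ℚ.≤ len P) where

    du≥0 : 0ℚ ℚ.≤ du
    du≥0 = subst (0ℚ ℚ.≤_) len[Pu] (len≥0 Pu)

    key-du≤ : ∀ {t ℓ} → G u t ≡ just ℓ → key du ℕ.≤ key (du ℚ.+ ℓ)
    key-du≤ e = key-mono-≤ du≥0 (p≤p+q (ℓ≥0 e))

    Exempt : List (Fin n) → Fin n → Fin n → Set
    Exempt ts p w = p ≡ u × w ∈ ts

    record Relaxing (ts : List (Fin n)) (c : Config ℚ H) : Set where
      field
        invariant : Invariant (Exempt ts) c (key du)
        u-done    : done c u ≡ true
        u-dist    : D c u ≡ just du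
    open Relaxing

    EdgeRelaxed : Config ℚ H → Fin n → Set
    EdgeRelaxed c t = ∀ ℓ → G u t ≡ just ℓ → Σ ℚ λ dt → D c t ≡ just dt × dt ℚ.≤ du ℚ.+ ℓ

    skip : ∀ {c t ts} → Relaxing (t ∷ ts) c → EdgeRelaxed c t → Relaxing ts c
    skip {c} {t} {ts} R relaxed =
      record { invariant = withFrontier (invariant R) frontier' ; u-done = u-done R ; u-dist = u-dist R }
      where
      frontier' : Frontier (Exempt ts) c
      frontier' p w not-exempt p-done ℓ e dp Dp with p Fin.≟ u | w Fin.≟ t
      ... | yes refl | yes refl with trans (sym (u-dist R)) Dp
      ...   | refl = relaxed ℓ e
      frontier' p w not-exempt p-done ℓ e dp Dp | yes refl | no w≢t =
        frontier (invariant R) p w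
                 (λ { (_ , here w≡t) → w≢t w≡t ; (_ , there w∈ts) → not-exempt (refl , w∈ts) })
                 p-done ℓ e dp Dp
      frontier' p w not-exempt p-done ℓ e dp Dp | no p≢u | _ =
        frontier (invariant R) p w (λ (p≡u , _) → p≢u p≡u) p-done ℓ e dp Dp

    lower : ∀ {c t ts ℓ q'} → Relaxing (t ∷ ts) c → G u t ≡ just ℓ → done c t ≡ false →
            (∀ dt → D c t ≡ just dt → du ℚ.+ ℓ ℚ.< dt) → Reach H q' (key du) →
            (∀ v → contents q' v ≡ update (contents (queue c)) t (just (key (du ℚ.+ ℓ))) v) →
            Relaxing ts (config (update (D c) t (just (du ℚ.+ ℓ))) (done c) q' (order c))
    lower {c} {t} {ts} {ℓ} {q'} R e t-undone improves reach' q'≗ = skip R' relaxed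
      where
      I : Invariant (Exempt (t ∷ ts)) c (key du)
      I = invariant R
      nd : ℚ
      nd = du ℚ.+ ℓ
      D' : Fin n → Maybe ℚ
      D' = update (D c) t (just nd)
      processed≢t : ∀ {v} → done c v ≡ true → v ≢ t
      processed≢t v-done refl = contradiction (trans (sym v-done) t-undone) λ ()
      s≢t : s ≢ t
      s≢t refl = ℚP.<-irrefl refl (ℚP.≤-<-trans (ℚP.+-mono-≤ du≥0 (ℓ≥0 e)) (improves 0ℚ (D-source I)))
      D'-u : D' u ≡ just du
      D'-u = trans (update-other (D c) t _ (processed≢t (u-done R))) (u-dist R)
      relaxed : EdgeRelaxed (config D' (done c) q' (order c)) t
      relaxed ℓ' e' with trans (sym e) e'
      ... | refl = nd , update-same (D c) t (just nd) , ℚP.≤-refl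
      contents' : ∀ v → contents q' v ≡ queueEntry (done c v) (D' v)
      contents' v with v Fin.≟ t
      ... | yes refl = trans (q'≗ v) (trans (update-same (contents (queue c)) v (just (key nd)))
                                            (cong (λ d → queueEntry d (just nd)) (sym t-undone)))
      ... | no v≢t = trans (q'≗ v) (trans (update-other (contents (queue c)) t _ v≢t) (queue-contents I v))
      attained : ∀ v dv → D' v ≡ just dv → Σ (Walk G s v) λ p → len p ≡ dv
      attained v dv Dv with v Fin.≟ t
      ... | yes refl = snoc Pu e , trans (len-snoc Pu e) (trans (cong (ℚ._+ ℓ) len[Pu]) (just-injective Dv))
      ... | no _ = D-attained I v dv Dv
      exact : ∀ v → done c v ≡ true → Σ ℚ λ dv → D' v ≡ just dv × (∀ (p : Walk G s v) → dv ℚ.≤ len p)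
      exact v v-done with done-exact I v v-done
      ... | dv , Dv , dv-min = dv , trans (update-other (D c) t _ (processed≢t v-done)) Dv , dv-min
      frontier' : Frontier (Exempt (t ∷ ts)) (config D' (done c) q' (order c))
      frontier' p w not-exempt p-done ℓ' e' dp Dp
        with frontier I p w not-exempt p-done ℓ' e' dp
                      (trans (sym (update-other (D c) t _ (processed≢t p-done))) Dp)
      ... | dw , Dw , dw≤ with w Fin.≟ t
      ...   | yes refl = nd , refl , ℚP.≤-trans (ℚP.<⇒≤ (improves dw Dw)) dw≤
      ...   | no _ = dw , Dw , dw≤
      R' : Relaxing (t ∷ ts) (config D' (done c) q' (order c))
      R' = record
        { invariant = record
          { queue-reach = reach' ; queue-contents = contents' ; D-attained = attained
          ; done-exact = exact ; frontier = frontier'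
          ; D-source = trans (update-other (D c) t _ s≢t) (D-source I)
          ; order-below = order-below I ; order-sorted = order-sorted I }
        ; u-done = u-done R ; u-dist = D'-u }

    relax-preserves : ∀ {c} t ts → Relaxing (t ∷ ts) c → Relaxing ts (relax du u c t)
    relax-preserves {c} t ts R with G u t in e | done c t in t-done | D c t in Dt
    ... | nothing | _ | _ = skip R λ ℓ e' → contradiction (trans (sym e) e') λ ()
    ... | just ℓ | true | _ = skip R relaxed
      where
      relaxed : EdgeRelaxed c t
      relaxed ℓ' e' with done-exact (invariant R) t t-done | trans (sym e) e'
      ... | dt , Dt' , dt-min | refl =
        dt , Dt' , ℚP.≤-trans (dt-min (snoc Pu e))
                              (ℚP.≤-reflexive (trans (len-snoc Pu e) (cong (ℚ._+ ℓ) len[Pu])))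
    ... | just ℓ | false | nothing =
      lower R e t-done (λ _ Dt' → contradiction (trans (sym Dt) Dt') λ ())
            (r-insert (queue-reach I) absent (key-du≤ e)) (contents-insert (queue-reach I) absent (key-du≤ e))
      where
      I : Invariant (Exempt (t ∷ ts)) c (key du)
      I = invariant R
      absent : contents (queue c) t ≡ nothing
      absent = trans (queue-contents I t) (cong₂ queueEntry t-done Dt)
    ... | just ℓ | false | just dt with (du ℚ.+ ℓ) <ᵇℚ dt | proof (du ℚ.+ ℓ ℚP.<? dt)
    ...   | false | ofⁿ ¬improves =
      skip R λ ℓ' e' → case trans (sym e) e' of λ { refl → dt , Dt , ℚP.≮⇒≥ ¬improves }
    ...   | true | ofʸ improves =
      lower R e t-done (λ _ Dt' → subst (du ℚ.+ ℓ ℚ.<_) (just-injective (trans (sym Dt) Dt')) improves)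
            (r-dec (queue-reach I) present key≤ (key-du≤ e))
            (contents-dec (queue-reach I) present key≤ (key-du≤ e))
      where
      I : Invariant (Exempt (t ∷ ts)) c (key du)
      I = invariant R
      present : contents (queue c) t ≡ just (key dt)
      present = queued I t-done Dt
      key≤ : key (du ℚ.+ ℓ) ℕ.≤ key dt
      key≤ = key-mono-≤ (ℚP.+-mono-≤ du≥0 (ℓ≥0 e)) (ℚP.<⇒≤ improves)

    relax-all : ∀ ts {c} → Relaxing ts c → Invariant NoExempt (foldl (relax du u) c ts) (key du)
    relax-all []       R = withFrontier (invariant R) λ p w _ → frontier (invariant R) p w λ ()
    relax-all (t ∷ ts) R = relax-all ts (relax-preserves t ts R)

  markDone : Fin n → State → Config ℚ H → Config ℚ H
  markDone u q' c = config (D c) (update (done c) u true) q' (order c ++ [ u ])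

  process-preserves : ∀ {c b u q'} → Invariant NoExempt c b → extract (queue c) ≡ just (u , q') →
                      Σ ℕ λ k → Invariant NoExempt (process u q' c) k
  process-preserves {c} {b} {u} {q'} I e with extract-just (queue-reach I) e
  ... | q'≗ , k , cu , b≤k with done c u in u-done | D c u in Du
  ... | true  | _       =
    contradiction (trans (sym cu) (trans (queue-contents I u) (cong₂ queueEntry u-done Du))) λ ()
  ... | false | nothing =
    contradiction (trans (sym cu) (trans (queue-contents I u) (cong₂ queueEntry u-done Du))) λ ()
  ... | false | just du =
    key du , relax-all (allFin n) marked
    where
    cu' : contents (queue c) u ≡ just (key du)
    cu' = queued I u-done Du
    b≤key[du] : b ℕ.≤ key du
    b≤key[du] = subst (b ℕ.≤_) (just-injective (trans (sym cu) cu')) b≤k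
    Pu : Walk G s u
    Pu = proj₁ (D-attained I u du Du)
    len[Pu] : len Pu ≡ du
    len[Pu] = proj₂ (D-attained I u du Du)
    du-exact : ∀ (P : Walk G s u) → du ℚ.≤ len P
    du-exact = extracted-exact I u-done Du (λ w j → extract-min (queue-reach I) e cu')
    open Relaxation u du Pu len[Pu] du-exact
    c' : Config ℚ H
    c' = markDone u q' c
    contents' : ∀ v → contents q' v ≡ queueEntry (done c' v) (D c v)
    contents' v with v Fin.≟ u
    ... | yes refl = trans (q'≗ v) (update-same (contents (queue c)) v nothing)
    ... | no v≢u =
      trans (q'≗ v) (trans (update-other (contents (queue c)) u nothing v≢u) (queue-contents I v))
    exact : ∀ v → done c' v ≡ true → Σ ℚ λ dv → D c v ≡ just dv × (∀ (p : Walk G s v) → dv ℚ.≤ len p)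
    exact v v-done with v Fin.≟ u
    ... | yes refl = du , Du , du-exact
    ... | no _ = done-exact I v v-done
    frontier' : Frontier (Exempt (allFin n)) c'
    frontier' p w not-exempt p-done with p Fin.≟ u
    ... | yes refl = contradiction (refl , ∈-allFin w) not-exempt
    ... | no _ = frontier I p w (λ ()) p-done
    order' : All (KeyBelow (key du)) (order c') × AllPairs KeyOrdered (order c')
    order' = extend-order (order-below I) (order-sorted I) b≤key[du]
               (λ x d → cong key (Dist-unique d (Pu , len[Pu]) du-exact))
    marked : Relaxing (allFin n) c'
    marked = record
      { invariant = record
        { queue-reach = r-ext (queue-reach I) e cu' ; queue-contents = contents' ; D-attained = D-attained I
        ; done-exact = exact ; frontier = frontier' ; D-source = D-source I
        ; order-below = proj₁ order' ; order-sorted = proj₂ order' }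
      ; u-done = update-same (done c) u true ; u-dist = Du }

  loop-sorted : ∀ fuel {c b} → Invariant NoExempt c b → AllPairs KeyOrdered (order (loop fuel c))
  loop-sorted ℕ.zero       I = order-sorted I
  loop-sorted (ℕ.suc fuel) {c} I with extract (queue c) in e
  ... | nothing       = order-sorted I
  ... | just (u , q') = loop-sorted fuel (proj₂ (process-preserves I e))

  initial-invariant : Invariant NoExempt (initial s) 0
  initial-invariant = record
    { queue-reach = r-insert r-empty (contents-empty s) ℕ.z≤n
    ; queue-contents = contents'
    ; D-attained = attained
    ; done-exact = λ v ()
    ; frontier = λ p w _ ()
    ; D-source = update-same (λ _ → nothing) s (just 0ℚ)
    ; order-below = []
    ; order-sorted = [] }
    where
    contents' : ∀ v → contents (insert s (key 0ℚ) empty) v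
                    ≡ queueEntry false (update (λ _ → nothing) s (just 0ℚ) v)
    contents' v with v Fin.≟ s | contents-insert r-empty (contents-empty s) ℕ.z≤n v
    ... | yes refl | eq = eq
    ... | no _     | eq = trans eq (contents-empty v)
    attained : ∀ v dv → update (λ _ → nothing) s (just 0ℚ) v ≡ just dv → Σ (Walk G s v) λ p → len p ≡ dv
    attained v dv Dv with v Fin.≟ s
    attained v dv refl | yes refl = [] , refl

  processingOrder-sorted : AllPairs KeyOrdered (processingOrder s)
  processingOrder-sorted = loop-sorted n initial-invariant

corollary2 : (H : (n : ℕ) → PQ n)
             → (∀ n → IsMonotonePQ (H n))
             → (∀ n (G : Graph ℕ n) (s : Fin n) → FullOrdering G s (dijkstraℕ (H n) G s))
             → ∀ n (G : Graph ℚ n) (s : Fin n) (δ : ℚ) (δ>0 : 0ℚ < δ)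
             → MinEdgeLength G δ
             → DeltaPO G s δ (dijkstraℚ (H n) G δ δ>0 s)
corollary2 H mono _ n G s δ δ>0 (δ≤ℓ , _) i j i<j x y dx dy =
  key≤⇒<+δ (Dist-nonNeg dx) (Dist-nonNeg dy) (lookup-AllPairs processingOrder-sorted i j i<j x y dx dy)
  where
  open Correctness (H n) (mono n) G s δ δ>0 δ≤ℓ
  open ScaledKey δ δ>0
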